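{- Let $A=\{a_1,\ldots,a_n\}$ be a set of positive integers with $a_1<a_2<\cdots<a_n$, let $\varepsilon\in(0,1)$, let $L=\{a\in A : a\ge \varepsilon\cdot a_n\}$ and let $l=\varepsilon^2\cdot a_n$. Suppose $L_1,L_2\subseteq L$ are two distinct subsets with $\Sigma(L_1)\le\Sigma(L_2)$ whose sums lie in a common bin, i.e. there is an integer $j\ge 0$ with $\Sigma(L_1),\Sigma(L_2)\in[j\,l,(j+1)\,l]$. Then the sets $L_1'=L_1\setminus L_2$ and $L_2'=L_2\setminus L_1$ are disjoint, nonempty, satisfy $\Sigma(L_1')\le\Sigma(L_2')$, and $$\frac{\Sigma(L_2')}{\Sigma(L_1')}\le 1+\varepsilon .$$
   Context: For a finite set $S$ of integers, $\Sigma(S)=\sum_{s\in S}s$ denotes the sum of its elements.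
   Formalization: The parameter ε ranges over the rationals in $(0,1)$. -}

module Defs where

open import Data.Nat using (ℕ; zero; suc; _+_)
open import Data.Fin using (Fin)
import Data.Fin as Fin
open import Data.Fin.Subset using (Subset; inside; outside)
open import Data.Vec using ([]; _∷_)
open import Data.Integer using (+_)
open import Data.Rational using (ℚ; _/_)

ΣS : ∀ {n} → (Fin n → ℕ) → Subset n → ℕ
ΣS {zero}  A []            = 0
ΣS {suc n} A (inside ∷ S)  = A Fin.zero + ΣS (λ i → A (Fin.suc i)) S
ΣS {suc n} A (outside ∷ S) = ΣS (λ i → A (Fin.suc i)) S

ℕ→ℚ : ℕ → ℚ
ℕ→ℚ n = + n / 1

{-# OPTIONS --safe #-}
-- Write L₁′ = L₁ ∖ L₂, L₂′ = L₂ ∖ L₁ and C = L₁ ∩ L₂, so that Σ(Lᵢ) = Σ(Lᵢ′) + Σ(C).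
-- Both sums lying in one bin of width l = ε²aₙ forces Σ(L₂′) ≤ Σ(L₁′) + ε·(ε aₙ).
-- Every element of L is at least ε aₙ, so a nonempty Lᵢ′ has Σ(Lᵢ′) ≥ ε aₙ.
-- If L₁′ were empty then L₂′ would not be (the sets differ), giving ε aₙ ≤ ε·(ε aₙ),
-- impossible for ε < 1; so Σ(L₁′) ≥ ε aₙ and hence Σ(L₂′) ≤ (1 + ε) Σ(L₁′).
module Submission where

open import Defs
open import Data.Nat using (ℕ; suc)
import Data.Nat as ℕ
open import Data.Fin using (Fin; fromℕ)
import Data.Fin as Fin
open import Data.Fin.Subset using (Subset; _∈_; _⊆_; _∩_; _─_; Nonempty; Empty)
open import Data.Rational using (ℚ; 0ℚ; 1ℚ; _+_; _*_; _≤_; _<_)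
open import Data.Product using (_×_)
open import Relation.Binary.PropositionalEquality using (_≢_)

import Data.Integer as ℤ
import Data.Integer.Properties as ℤ
open import Data.Fin.Subset using (inside; outside; _∉_)
open import Data.Fin.Subset.Properties
  using (_∈?_; nonempty?; ⊆-antisym; p─q⊆p; x∈p∧x∉q⇒x∈p─q; x∈p∩q⁻; ∩-comm)
open import Data.Nat.Coprimality as Coprimality using (1-coprimeTo)
import Data.Nat.Properties as ℕ
open import Algebra.Properties.CommutativeSemigroup ℕ.+-commutativeSemigroup using (x∙yz≈y∙xz)
open import Data.Product using (_,_)
import Data.Product as Product
open import Data.Rational using (mkℚ; _/_; -_; Positive; NonNegative; positive)
open import Data.Rational.Properties
open import Data.Vec using ([]; _∷_; here; there)
open import Function using (_∘_)
open import Relation.Nullary using (yes; no; contradiction)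
open import Relation.Binary.PropositionalEquality
  using (_≡_; refl; sym; trans; cong; cong₂; subst; subst₂; module ≡-Reasoning)

private
  variable
    n : ℕ

ℕ→ℚ≡mkℚ : ∀ k → ℕ→ℚ k ≡ mkℚ (ℤ.+ k) 0 (Coprimality.sym (1-coprimeTo k))
ℕ→ℚ≡mkℚ k = normalize-coprime _

ℕ→ℚ-nonNeg : ∀ k → NonNegative (ℕ→ℚ k)
ℕ→ℚ-nonNeg k = subst NonNegative (sym (ℕ→ℚ≡mkℚ k)) _

ℕ→ℚ-pos : ∀ {k} → 0 ℕ.< k → Positive (ℕ→ℚ k)
ℕ→ℚ-pos {suc k} _ = subst Positive (sym (ℕ→ℚ≡mkℚ (suc k))) _

ℕ→ℚ-homo-+ : ∀ a b → ℕ→ℚ (a ℕ.+ b) ≡ ℕ→ℚ a + ℕ→ℚ b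
-- On normal forms with denominator 1, _+_ computes to a fraction over 1.
ℕ→ℚ-homo-+ a b = sym (begin
  ℕ→ℚ a + ℕ→ℚ b
    ≡⟨ cong₂ _+_ (ℕ→ℚ≡mkℚ a) (ℕ→ℚ≡mkℚ b) ⟩
  (ℤ.+ a ℤ.* ℤ.1ℤ ℤ.+ ℤ.+ b ℤ.* ℤ.1ℤ) / 1
    ≡⟨ cong (_/ 1) (cong₂ ℤ._+_ (ℤ.*-identityʳ (ℤ.+ a)) (ℤ.*-identityʳ (ℤ.+ b))) ⟩
  ℕ→ℚ (a ℕ.+ b)
    ∎)
  where open ≡-Reasoning

ℕ→ℚ-mono-≤ : ∀ {a b} → a ℕ.≤ b → ℕ→ℚ a ≤ ℕ→ℚ b
ℕ→ℚ-mono-≤ {a} {b} a≤b = begin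
  ℕ→ℚ a                    ≡⟨ +-identityʳ (ℕ→ℚ a) ⟨
  ℕ→ℚ a + 0ℚ               ≤⟨ +-monoʳ-≤ (ℕ→ℚ a) (nonNegative⁻¹ _ {{ℕ→ℚ-nonNeg (b ℕ.∸ a)}}) ⟩
  ℕ→ℚ a + ℕ→ℚ (b ℕ.∸ a)    ≡⟨ ℕ→ℚ-homo-+ a (b ℕ.∸ a) ⟨
  ℕ→ℚ (a ℕ.+ (b ℕ.∸ a))    ≡⟨ cong ℕ→ℚ (ℕ.m+[n∸m]≡n a≤b) ⟩
  ℕ→ℚ b                    ∎
  where open ≤-Reasoning

+-cancelʳ-≤ : ∀ r p q → p + r ≤ q + r → p ≤ q
+-cancelʳ-≤ r p q p+r≤q+r = subst₂ _≤_ (+-r-cancel p) (+-r-cancel q) (+-monoˡ-≤ (- r) p+r≤q+r)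
  where
  open ≡-Reasoning
  +-r-cancel : ∀ x → x + r + - r ≡ x
  +-r-cancel x = begin
    x + r + - r    ≡⟨ +-assoc x r (- r) ⟩
    x + (r + - r)  ≡⟨ cong (x +_) (+-inverseʳ r) ⟩
    x + 0ℚ         ≡⟨ +-identityʳ x ⟩
    x              ∎

p<1⇒p*q<q : ∀ {p} q .{{_ : Positive q}} → p < 1ℚ → p * q < q
p<1⇒p*q<q {p} q p<1 = subst (p * q <_) (*-identityˡ q) (*-monoˡ-<-pos q p<1)

sameBin⇒≤width+ : ∀ j l {x y} → ℕ→ℚ j * l ≤ x → y ≤ ℕ→ℚ (suc j) * l → y ≤ l + x
sameBin⇒≤width+ j l {x} {y} jl≤x y≤[1+j]l = begin
  y                    ≤⟨ y≤[1+j]l ⟩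
  ℕ→ℚ (suc j) * l      ≡⟨ cong (_* l) (ℕ→ℚ-homo-+ 1 j) ⟩
  (1ℚ + ℕ→ℚ j) * l     ≡⟨ *-distribʳ-+ l 1ℚ (ℕ→ℚ j) ⟩
  1ℚ * l + ℕ→ℚ j * l   ≤⟨ +-monoʳ-≤ (1ℚ * l) jl≤x ⟩
  1ℚ * l + x           ≡⟨ cong (_+ x) (*-identityˡ l) ⟩
  l + x                ∎
  where open ≤-Reasoning

≤ε*lb+⇒≤[1+ε]* : ∀ {s t b} ε .{{_ : NonNegative ε}} → t ≤ ε * b + s → b ≤ s → t ≤ (1ℚ + ε) * s
≤ε*lb+⇒≤[1+ε]* {s} {t} {b} ε t≤εb+s b≤s = begin
  t                ≤⟨ t≤εb+s ⟩
  ε * b + s        ≤⟨ +-monoˡ-≤ s (*-monoˡ-≤-nonNeg ε b≤s) ⟩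
  ε * s + s        ≡⟨ +-comm (ε * s) s ⟩
  s + ε * s        ≡⟨ cong (_+ ε * s) (*-identityˡ s) ⟨
  1ℚ * s + ε * s   ≡⟨ *-distribʳ-+ s 1ℚ ε ⟨
  (1ℚ + ε) * s     ∎
  where open ≤-Reasoning

x∈p─q⇒x∉q : ∀ {p q : Subset n} {x} → x ∈ p ─ q → x ∉ q
x∈p─q⇒x∉q {p = _ ∷ p} {inside  ∷ q} (there x∈p─q) (there x∈q) = x∈p─q⇒x∉q {p = p} x∈p─q x∈q
x∈p─q⇒x∉q {p = _ ∷ p} {outside ∷ q} (there x∈p─q) (there x∈q) = x∈p─q⇒x∉q {p = p} x∈p─q x∈q

─-disjoint : ∀ (p q : Subset n) → Empty ((p ─ q) ∩ (q ─ p))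
─-disjoint p q (x , x∈both) with x∈p∩q⁻ (p ─ q) (q ─ p) x∈both
... | x∈p─q , x∈q─p = x∈p─q⇒x∉q {p = p} x∈p─q (p─q⊆p q p x∈q─p)

Empty─⇒⊆ : ∀ {p q : Subset n} → Empty (p ─ q) → p ⊆ q
Empty─⇒⊆ {q = q} p─q≡∅ {x} x∈p with x ∈? q
... | yes x∈q = x∈q
... | no  x∉q = contradiction (x , x∈p∧x∉q⇒x∈p─q x∈p x∉q) p─q≡∅

≢∧Empty─⇒Nonempty─ : ∀ {p q : Subset n} → p ≢ q → Empty (p ─ q) → Nonempty (q ─ p)
≢∧Empty─⇒Nonempty─ {p = p} {q} p≢q p─q≡∅ with nonempty? (q ─ p)
... | yes q─p≢∅ = q─p≢∅
... | no  q─p≡∅ = contradiction (⊆-antisym (Empty─⇒⊆ p─q≡∅) (Empty─⇒⊆ q─p≡∅)) p≢q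

ΣS-─-∩ : ∀ (A : Fin n → ℕ) S T → ΣS A S ≡ ΣS A (S ─ T) ℕ.+ ΣS A (S ∩ T)
ΣS-─-∩ A []            []            = refl
ΣS-─-∩ A (inside  ∷ S) (inside  ∷ T) =
  trans (cong (A Fin.zero ℕ.+_) (ΣS-─-∩ (A ∘ Fin.suc) S T))
        (x∙yz≈y∙xz (A Fin.zero) (ΣS (A ∘ Fin.suc) (S ─ T)) (ΣS (A ∘ Fin.suc) (S ∩ T)))
ΣS-─-∩ A (inside  ∷ S) (outside ∷ T) =
  trans (cong (A Fin.zero ℕ.+_) (ΣS-─-∩ (A ∘ Fin.suc) S T)) (sym (ℕ.+-assoc (A Fin.zero) _ _))
ΣS-─-∩ A (outside ∷ S) (inside  ∷ T) = ΣS-─-∩ (A ∘ Fin.suc) S T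
ΣS-─-∩ A (outside ∷ S) (outside ∷ T) = ΣS-─-∩ (A ∘ Fin.suc) S T

ΣS-─-∩′ : ∀ (A : Fin n → ℕ) S T → ΣS A T ≡ ΣS A (T ─ S) ℕ.+ ΣS A (S ∩ T)
ΣS-─-∩′ A S T = trans (ΣS-─-∩ A T S) (cong (λ U → ΣS A (T ─ S) ℕ.+ ΣS A U) (∩-comm T S))

ΣS-≤⇒ΣS-─-≤ : ∀ (A : Fin n → ℕ) S T → ΣS A S ℕ.≤ ΣS A T → ΣS A (S ─ T) ℕ.≤ ΣS A (T ─ S)
ΣS-≤⇒ΣS-─-≤ A S T ΣS≤ΣT =
  ℕ.+-cancelʳ-≤ (ΣS A (S ∩ T)) _ _ (subst₂ ℕ._≤_ (ΣS-─-∩ A S T) (ΣS-─-∩′ A S T) ΣS≤ΣT)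

ΣS-≤+⇒ΣS-─-≤+ : ∀ (A : Fin n → ℕ) S T w → ℕ→ℚ (ΣS A T) ≤ w + ℕ→ℚ (ΣS A S) →
                ℕ→ℚ (ΣS A (T ─ S)) ≤ w + ℕ→ℚ (ΣS A (S ─ T))
ΣS-≤+⇒ΣS-─-≤+ A S T w ΣT≤w+ΣS = +-cancelʳ-≤ common _ _ (begin
  ℕ→ℚ (ΣS A (T ─ S)) + common            ≡⟨ ℕ→ℚ-homo-+ (ΣS A (T ─ S)) (ΣS A (S ∩ T)) ⟨
  ℕ→ℚ (ΣS A (T ─ S) ℕ.+ ΣS A (S ∩ T))    ≡⟨ cong ℕ→ℚ (ΣS-─-∩′ A S T) ⟨
  ℕ→ℚ (ΣS A T)                            ≤⟨ ΣT≤w+ΣS ⟩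
  w + ℕ→ℚ (ΣS A S)                        ≡⟨ cong (λ k → w + ℕ→ℚ k) (ΣS-─-∩ A S T) ⟩
  w + ℕ→ℚ (ΣS A (S ─ T) ℕ.+ ΣS A (S ∩ T)) ≡⟨ cong (w +_) (ℕ→ℚ-homo-+ (ΣS A (S ─ T)) (ΣS A (S ∩ T))) ⟩
  w + (ℕ→ℚ (ΣS A (S ─ T)) + common)       ≡⟨ +-assoc w _ common ⟨
  w + ℕ→ℚ (ΣS A (S ─ T)) + common         ∎)
  where
  open ≤-Reasoning
  common = ℕ→ℚ (ΣS A (S ∩ T))

ΣS-empty : ∀ (A : Fin n → ℕ) S → Empty S → ΣS A S ≡ 0
ΣS-empty A []            S≡∅ = refl
ΣS-empty A (inside  ∷ S) S≡∅ = contradiction (Fin.zero , here) S≡∅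
ΣS-empty A (outside ∷ S) S≡∅ = ΣS-empty (A ∘ Fin.suc) S (S≡∅ ∘ Product.map Fin.suc there)

ΣS-pos⇒nonempty : ∀ (A : Fin n → ℕ) S → 0 ℕ.< ΣS A S → Nonempty S
ΣS-pos⇒nonempty A (inside  ∷ S) _   = Fin.zero , here
ΣS-pos⇒nonempty A (outside ∷ S) pos = Product.map Fin.suc there (ΣS-pos⇒nonempty (A ∘ Fin.suc) S pos)

∈⇒≤ΣS : ∀ (A : Fin n → ℕ) S {i} → i ∈ S → A i ℕ.≤ ΣS A S
∈⇒≤ΣS A (inside  ∷ S) here        = ℕ.m≤m+n _ _
∈⇒≤ΣS A (inside  ∷ S) (there i∈S) = ℕ.≤-trans (∈⇒≤ΣS (A ∘ Fin.suc) S i∈S) (ℕ.m≤n+m _ (A Fin.zero))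
∈⇒≤ΣS A (outside ∷ S) (there i∈S) = ∈⇒≤ΣS (A ∘ Fin.suc) S i∈S

ΣS-lowerBound : ∀ (A : Fin n → ℕ) S {b} → (∀ i → i ∈ S → b ≤ ℕ→ℚ (A i)) →
                Nonempty S → b ≤ ℕ→ℚ (ΣS A S)
ΣS-lowerBound A S b≤A (i , i∈S) = ≤-trans (b≤A i i∈S) (ℕ→ℚ-mono-≤ (∈⇒≤ΣS A S i∈S))

lemma1 : (m : ℕ) (A : Fin (suc m) → ℕ)
    → (∀ i → 0 ℕ.< A i)
    → (∀ i j → i Fin.< j → A i ℕ.< A j)
    → (ε : ℚ) → 0ℚ < ε → ε < 1ℚ
    → (L₁ L₂ : Subset (suc m))
    → (∀ i → i ∈ L₁ → ε * ℕ→ℚ (A (fromℕ m)) ≤ ℕ→ℚ (A i))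
    → (∀ i → i ∈ L₂ → ε * ℕ→ℚ (A (fromℕ m)) ≤ ℕ→ℚ (A i))
    → L₁ ≢ L₂
    → ΣS A L₁ ℕ.≤ ΣS A L₂
    → (j : ℕ)
    → ℕ→ℚ j * (ε * ε * ℕ→ℚ (A (fromℕ m))) ≤ ℕ→ℚ (ΣS A L₁)
    → ℕ→ℚ (ΣS A L₁) ≤ ℕ→ℚ (suc j) * (ε * ε * ℕ→ℚ (A (fromℕ m)))
    → ℕ→ℚ j * (ε * ε * ℕ→ℚ (A (fromℕ m))) ≤ ℕ→ℚ (ΣS A L₂)
    → ℕ→ℚ (ΣS A L₂) ≤ ℕ→ℚ (suc j) * (ε * ε * ℕ→ℚ (A (fromℕ m)))
    → Empty ((L₁ ─ L₂) ∩ (L₂ ─ L₁))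
    × Nonempty (L₁ ─ L₂)
    × Nonempty (L₂ ─ L₁)
    × ΣS A (L₁ ─ L₂) ℕ.≤ ΣS A (L₂ ─ L₁)
    × ℕ→ℚ (ΣS A (L₂ ─ L₁)) ≤ (1ℚ + ε) * ℕ→ℚ (ΣS A (L₁ ─ L₂))
lemma1 m A A>0 _ ε 0<ε ε<1 L₁ L₂ large₁ large₂ L₁≢L₂ ΣL₁≤ΣL₂ j lo₁ _ _ hi₂ =
  ─-disjoint L₁ L₂ , L₁′≢∅ , L₂′≢∅ , ΣL₁′≤ΣL₂′ , ≤ε*lb+⇒≤[1+ε]* ε gap (εaₙ≤ΣS─ L₁ L₂ large₁ L₁′≢∅)
  where
  aₙ = ℕ→ℚ (A (fromℕ m))
  instance
    ε-pos : Positive ε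
    ε-pos = positive 0<ε
    ε-nonNeg : NonNegative ε
    ε-nonNeg = pos⇒nonNeg ε
    εaₙ-pos : Positive (ε * aₙ)
    εaₙ-pos = pos*pos⇒pos ε aₙ {{ℕ→ℚ-pos (A>0 (fromℕ m))}}

  εaₙ≤ΣS─ : ∀ S T → (∀ i → i ∈ S → ε * aₙ ≤ ℕ→ℚ (A i)) →
            Nonempty (S ─ T) → ε * aₙ ≤ ℕ→ℚ (ΣS A (S ─ T))
  εaₙ≤ΣS─ S T large = ΣS-lowerBound A (S ─ T) (λ i → large i ∘ p─q⊆p S T)

  ΣL₁′≤ΣL₂′ : ΣS A (L₁ ─ L₂) ℕ.≤ ΣS A (L₂ ─ L₁)
  ΣL₁′≤ΣL₂′ = ΣS-≤⇒ΣS-─-≤ A L₁ L₂ ΣL₁≤ΣL₂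

  gap : ℕ→ℚ (ΣS A (L₂ ─ L₁)) ≤ ε * (ε * aₙ) + ℕ→ℚ (ΣS A (L₁ ─ L₂))
  gap = ΣS-≤+⇒ΣS-─-≤+ A L₁ L₂ (ε * (ε * aₙ))
          (subst (λ l → ℕ→ℚ (ΣS A L₂) ≤ l + ℕ→ℚ (ΣS A L₁)) (*-assoc ε ε aₙ)
                 (sameBin⇒≤width+ j (ε * ε * aₙ) lo₁ hi₂))

  L₁′≢∅ : Nonempty (L₁ ─ L₂)
  L₁′≢∅ with nonempty? (L₁ ─ L₂)
  ... | yes ne = ne
  ... | no  L₁′≡∅ = contradiction (begin-strict
    ε * aₙ                                    ≤⟨ εaₙ≤ΣS─ L₂ L₁ large₂ (≢∧Empty─⇒Nonempty─ L₁≢L₂ L₁′≡∅) ⟩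
    ℕ→ℚ (ΣS A (L₂ ─ L₁))                      ≤⟨ gap ⟩
    ε * (ε * aₙ) + ℕ→ℚ (ΣS A (L₁ ─ L₂))       ≡⟨ cong (λ k → ε * (ε * aₙ) + ℕ→ℚ k) (ΣS-empty A _ L₁′≡∅) ⟩
    ε * (ε * aₙ) + 0ℚ                         ≡⟨ +-identityʳ _ ⟩
    ε * (ε * aₙ)                              <⟨ p<1⇒p*q<q (ε * aₙ) ε<1 ⟩
    ε * aₙ                                    ∎) (<-irrefl refl)
    where open ≤-Reasoning

  L₂′≢∅ : Nonempty (L₂ ─ L₁)
  L₂′≢∅ with L₁′≢∅
  ... | i , i∈L₁′ =
    ΣS-pos⇒nonempty A (L₂ ─ L₁) (ℕ.<-≤-trans (A>0 i) (ℕ.≤-trans (∈⇒≤ΣS A _ i∈L₁′) ΣL₁′≤ΣL₂′))
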